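{- Let $U$ be a finite set of user types, $\pi$ a probability distribution on $U$, $M$ a finite set of movies, $p_{m,u} \in [0,1]$ for each $m \in M$, $u \in U$, and $\theta_u$ a positive integer for each $u \in U$. For a finite sequence $S = s_1 s_2 \dots s_{|S|}$ of movies define $$f(S) = \sum_{u \in U} \pi_u \left(1 - \prod_{j=1}^{\min\{\theta_u, |S|\}} (1 - p_{s_j,u})\right).$$ Then $f$ is ordered-submodular. Consequently, for every integer $k \ge 1$, the length-$k$ list $A_k$ produced by the greedy algorithm satisfies $f(A_k) \ge \frac12 \max\{ f(S) : S \text{ a sequence of } k \text{ movies}\}$.
   Context: For sequences $A, B$, $A\|B$ denotes concatenation and $A\|s$ denotes $A$ with element $s$ appended; $\emptyset$ is the empty sequence. A function $f$ on finite sequences of elements of $M$ is ordered-submodular if for all sequences $A$, $B$ and all elements $s, \bar s \in M$: $f(A\|s) - f(A) \ge f(A\|s\|B) - f(A\|\bar s\|B)$. The greedy algorithm: $A_0 = \emptyset$; for $\ell = 1,\dots,k$, $A_\ell = A_{\ell-1}\|a$ where $a \in M$ maximizes $f(A_{\ell-1}\|a)$ (ties broken arbitrarily). Interpretation: $f(S)$ is the probability that a random user of type drawn from $\pi$, who inspects only the first $\theta_u$ items, likes at least one inspected item, where movie $m$ independently pleases type $u$ with probability $p_{m,u}$. -}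

module Defs where

open import Level using (Level; _⊔_; suc)
open import Data.Nat using (ℕ; zero; suc; NonZero)
open import Data.Fin using (Fin)
import Data.Fin as Fin
open import Data.List using (List; []; _∷_; _∷ʳ_; _++_; take; map; foldr; length)
open import Algebra.Bundles using (CommutativeRing)
open import Relation.Binary.Structures using (IsTotalOrder)

-- The real numbers are an instance; the paper's
-- quantities (probabilities) live in ℝ.
record OrderedCommRing (c ℓ ℓ' : Level) : Set (Level.suc (c ⊔ ℓ ⊔ ℓ')) where
  field
    commRing : CommutativeRing c ℓ
  open CommutativeRing commRing public
  field
    _≤_         : Carrier → Carrier → Set ℓ'
    isTotalOrder : IsTotalOrder _≈_ _≤_
    +-mono      : ∀ {x y} z → x ≤ y → (x + z) ≤ (y + z)
    *-nonneg    : ∀ {x y} → 0# ≤ x → 0# ≤ y → 0# ≤ (x * y)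

module _ {c ℓ ℓ'} (R : OrderedCommRing c ℓ ℓ') where
  open OrderedCommRing R

  sumFin : ∀ {n} → (Fin n → Carrier) → Carrier
  sumFin {zero}  g = 0#
  sumFin {suc n} g = g Fin.zero + sumFin (λ i → g (Fin.suc i))

  prod : List Carrier → Carrier
  prod = foldr _*_ 1#

  -- f(S) = Σ_u π_u (1 - Π_{j=1}^{min(θ_u,|S|)} (1 - p_{s_j,u}));
  -- take (θ u) S is the prefix s_1 … s_{min(θ_u,|S|)}.
  movieF : ∀ {nU nM} → (π : Fin nU → Carrier) → (p : Fin nM → Fin nU → Carrier)
         → (θ : Fin nU → ℕ) → List (Fin nM) → Carrier
  movieF π p θ S = sumFin (λ u → π u * (1# - prod (map (λ m → 1# - p m u) (take (θ u) S))))

  OrderedSubmodular : ∀ {a} {X : Set a} → (List X → Carrier) → Set (a ⊔ ℓ')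
  OrderedSubmodular {X = X} f =
    ∀ (A B : List X) (s s̄ : X) →
      (f (A ++ (s ∷ B)) - f (A ++ (s̄ ∷ B))) ≤ (f (A ∷ʳ s) - f A)

  -- Greedy A : A is a possible output of the greedy algorithm (any tie-breaking)
  data Greedy {a} {X : Set a} (f : List X → Carrier) : List X → Set (a ⊔ ℓ') where
    start : Greedy f []
    step  : ∀ {A} (x : X) → Greedy f A → (∀ (y : X) → f (A ∷ʳ y) ≤ f (A ∷ʳ x))
          → Greedy f (A ∷ʳ x)

-- Fix a user type u and let Q(S) be the product of the q_m = 1 - p_{m,u} over the first
-- θ_u items of S, so that f = Σ_u π_u (1 - Q).  Ordered submodularity of 1 - Q says
-- Q(A‖s) + Q(A‖s̄‖B) ≤ Q(A‖s‖B) + Q(A).  If A already fills the first θ_u positions all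
-- four terms coincide; otherwise Q(A) is a common non-negative factor, and what remains
-- is q̄ P + q ≤ q P + 1 for q, q̄, P ∈ [0,1]: this is q̄ P ≤ P plus (1 - q)(1 - P) ≥ 0.
-- Non-negative combinations preserve ordered submodularity, so f has it.
--
-- For the greedy bound, replace the items of an arbitrary S by the greedy choices one at
-- a time, from the back: ordered submodularity and the choice rule give
-- f(T‖B) + f(∅) ≤ f(A‖B) + f(A) whenever A is greedy and |T| = |A|.  With B = ∅ and
-- f(∅) = 0 this is f(S) ≤ 2 f(A).

module Submission where

open import Defs
open import Level using (_⊔_)
open import Data.Nat using (ℕ; zero; suc; _<_)
import Data.Nat.Properties as ℕ
open import Data.Fin using (Fin)
import Data.Fin as Fin
open import Data.List using (List; []; _∷_; [_]; _∷ʳ_; _++_; take; map; length; initLast; _∷ʳ′_)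
open import Data.List.Properties using (take-[]; ++-assoc; ++-identityʳ; length-++)
open import Data.Product using (_×_; _,_; proj₁; proj₂)
open import Data.Sum using (inj₁; inj₂)
open import Data.Empty using (⊥-elim)
open import Function using (flip)
import Relation.Binary.PropositionalEquality as ≡
open import Relation.Binary.PropositionalEquality using (_≡_)
open import Relation.Binary.Bundles using (Poset)
open import Relation.Binary.Structures using (IsTotalOrder)
import Relation.Binary.Reasoning.PartialOrder as PartialOrderReasoning
import Algebra.Properties.AbelianGroup as AbelianGroupProperties
import Algebra.Properties.Ring as RingProperties
import Algebra.Properties.CommutativeSemigroup as CommutativeSemigroupProperties

length-∷ʳ : ∀ {a} {X : Set a} (xs : List X) x → length (xs ∷ʳ x) ≡ suc (length xs)
length-∷ʳ xs x = ≡.trans (length-++ xs) (ℕ.+-comm (length xs) 1)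

module OrderedCommRingProperties {c ℓ ℓ'} (R : OrderedCommRing c ℓ ℓ') where
  open OrderedCommRing R
  open IsTotalOrder isTotalOrder using (total)
    renaming (refl to ≤-refl; trans to ≤-trans; reflexive to ≤-reflexive)
  open AbelianGroupProperties +-abelianGroup
    using (//-rightDividesˡ; //-rightDividesʳ; ⁻¹-∙-comm; ⁻¹-involutive; ε⁻¹≈ε)
  open RingProperties ring using (-1*x≈-x; -‿distribʳ-*)
  open CommutativeSemigroupProperties +-commutativeSemigroup using (interchange; x∙yz≈y∙xz)

  poset : Poset c ℓ ℓ'
  poset = record { isPartialOrder = IsTotalOrder.isPartialOrder isTotalOrder }

  open PartialOrderReasoning poset

  +-monoʳ-≤ : ∀ z {x y} → x ≤ y → (z + x) ≤ (z + y)
  +-monoʳ-≤ z {x} {y} x≤y = begin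
    z + x  ≈⟨ +-comm z x ⟩
    x + z  ≤⟨ +-mono z x≤y ⟩
    y + z  ≈⟨ +-comm y z ⟩
    z + y  ∎

  +-mono-≤ : ∀ {x y u v} → x ≤ y → u ≤ v → (x + u) ≤ (y + v)
  +-mono-≤ {y = y} {u = u} x≤y u≤v = ≤-trans (+-mono u x≤y) (+-monoʳ-≤ y u≤v)

  +-cancelʳ-≤ : ∀ z {x y} → (x + z) ≤ (y + z) → x ≤ y
  +-cancelʳ-≤ z {x} {y} x+z≤y+z = begin
    x            ≈⟨ //-rightDividesʳ z x ⟨
    (x + z) - z  ≤⟨ +-mono (- z) x+z≤y+z ⟩
    (y + z) - z  ≈⟨ //-rightDividesʳ z y ⟩
    y            ∎

  x≤y⇒0≤y-x : ∀ {x y} → x ≤ y → 0# ≤ (y - x)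
  x≤y⇒0≤y-x {x} {y} x≤y = begin
    0#     ≈⟨ -‿inverseʳ x ⟨
    x - x  ≤⟨ +-mono (- x) x≤y ⟩
    y - x  ∎

  0≤y-x⇒x≤y : ∀ {x y} → 0# ≤ (y - x) → x ≤ y
  0≤y-x⇒x≤y {x} {y} 0≤y-x = begin
    x             ≈⟨ +-identityˡ x ⟨
    0# + x        ≤⟨ +-mono x 0≤y-x ⟩
    (y - x) + x   ≈⟨ //-rightDividesˡ x y ⟩
    y             ∎

  neg-antimono-≤ : ∀ {x y} → x ≤ y → (- y) ≤ (- x)
  neg-antimono-≤ {x} {y} x≤y = 0≤y-x⇒x≤y (begin
    0#          ≤⟨ x≤y⇒0≤y-x x≤y ⟩
    y - x       ≈⟨ +-comm y (- x) ⟩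
    - x + y     ≈⟨ +-congˡ (⁻¹-involutive y) ⟨
    - x - - y   ∎)

  *-monoʳ-≤-nonNeg : ∀ {z x y} → 0# ≤ z → x ≤ y → (z * x) ≤ (z * y)
  *-monoʳ-≤-nonNeg {z} {x} {y} 0≤z x≤y = 0≤y-x⇒x≤y (begin
    0#               ≤⟨ *-nonneg 0≤z (x≤y⇒0≤y-x x≤y) ⟩
    z * (y - x)      ≈⟨ distribˡ z y (- x) ⟩
    z * y + z * - x  ≈⟨ +-congˡ (-‿distribʳ-* z x) ⟨
    z * y - z * x    ∎)

  *-monoˡ-≤-nonNeg : ∀ {z x y} → 0# ≤ z → x ≤ y → (x * z) ≤ (y * z)
  *-monoˡ-≤-nonNeg {z} {x} {y} 0≤z x≤y = begin
    x * z  ≈⟨ *-comm x z ⟩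
    z * x  ≤⟨ *-monoʳ-≤-nonNeg 0≤z x≤y ⟩
    z * y  ≈⟨ *-comm z y ⟩
    y * z  ∎

  0≤1 : 0# ≤ 1#
  0≤1 with total 0# 1#
  ... | inj₁ 0≤1 = 0≤1
  ... | inj₂ 1≤0 = begin
    0#              ≤⟨ *-nonneg 0≤-1 0≤-1 ⟩
    - 1# * - 1#     ≈⟨ -1*x≈-x (- 1#) ⟩
    - - 1#          ≈⟨ ⁻¹-involutive 1# ⟩
    1#              ∎
    where
    0≤-1 : 0# ≤ (- 1#)
    0≤-1 = ≤-trans (≤-reflexive (sym ε⁻¹≈ε)) (neg-antimono-≤ 1≤0)

  [x+w]+[-y+-w]≈x-y : ∀ x y w → (x + w) + (- y + - w) ≈ x - y
  [x+w]+[-y+-w]≈x-y x y w = begin-equality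
    (x + w) + (- y + - w)  ≈⟨ interchange x w (- y) (- w) ⟩
    (x - y) + (w - w)      ≈⟨ +-congˡ (-‿inverseʳ w) ⟩
    (x - y) + 0#           ≈⟨ +-identityʳ (x - y) ⟩
    x - y                  ∎

  x+w≤z+y⇒x-y≤z-w : ∀ {x y z w} → (x + w) ≤ (z + y) → (x - y) ≤ (z - w)
  x+w≤z+y⇒x-y≤z-w {x} {y} {z} {w} x+w≤z+y = begin
    x - y                  ≈⟨ [x+w]+[-y+-w]≈x-y x y w ⟨
    (x + w) + (- y + - w)  ≤⟨ +-mono (- y + - w) x+w≤z+y ⟩
    (z + y) + (- y + - w)  ≈⟨ +-congˡ (+-comm (- y) (- w)) ⟩
    (z + y) + (- w + - y)  ≈⟨ [x+w]+[-y+-w]≈x-y z w y ⟩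
    z - w                  ∎

  x-y≤z-w⇒x+w≤z+y : ∀ {x y z w} → (x - y) ≤ (z - w) → (x + w) ≤ (z + y)
  x-y≤z-w⇒x+w≤z+y {x} {y} {z} {w} x-y≤z-w = +-cancelʳ-≤ (- y + - w) (begin
    (x + w) + (- y + - w)  ≈⟨ [x+w]+[-y+-w]≈x-y x y w ⟩
    x - y                  ≤⟨ x-y≤z-w ⟩
    z - w                  ≈⟨ [x+w]+[-y+-w]≈x-y z w y ⟨
    (z + y) + (- w + - y)  ≈⟨ +-congˡ (+-comm (- w) (- y)) ⟩
    (z + y) + (- y + - w)  ∎)

  [k-x]+[k-y]≈[k+k]-[x+y] : ∀ k x y → (k - x) + (k - y) ≈ (k + k) - (x + y)
  [k-x]+[k-y]≈[k+k]-[x+y] k x y = begin-equality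
    (k - x) + (k - y)      ≈⟨ interchange k (- x) k (- y) ⟩
    (k + k) + (- x + - y)  ≈⟨ +-congˡ (⁻¹-∙-comm x y) ⟩
    (k + k) - (x + y)      ∎

  x+y≤z+w⇒[k-z]+[k-w]≤[k-x]+[k-y] : ∀ k {x y z w} → (x + y) ≤ (z + w) →
                                    ((k - z) + (k - w)) ≤ ((k - x) + (k - y))
  x+y≤z+w⇒[k-z]+[k-w]≤[k-x]+[k-y] k {x} {y} {z} {w} x+y≤z+w = begin
    (k - z) + (k - w)  ≈⟨ [k-x]+[k-y]≈[k+k]-[x+y] k z w ⟩
    (k + k) - (z + w)  ≤⟨ +-monoʳ-≤ (k + k) (neg-antimono-≤ x+y≤z+w) ⟩
    (k + k) - (x + y)  ≈⟨ [k-x]+[k-y]≈[k+k]-[x+y] k x y ⟨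
    (k - x) + (k - y)  ∎

  infix 4 _∈[0,1]

  _∈[0,1] : Carrier → Set ℓ'
  x ∈[0,1] = 0# ≤ x × x ≤ 1#

  1-x∈[0,1] : ∀ {x} → x ∈[0,1] → (1# - x) ∈[0,1]
  1-x∈[0,1] {x} (0≤x , x≤1) = x≤y⇒0≤y-x x≤1 , (begin
    1# - x   ≤⟨ +-monoʳ-≤ 1# (neg-antimono-≤ 0≤x) ⟩
    1# - 0#  ≈⟨ +-congˡ ε⁻¹≈ε ⟩
    1# + 0#  ≈⟨ +-identityʳ 1# ⟩
    1#       ∎)

  x*y≤x : ∀ {x y} → 0# ≤ x → y ≤ 1# → (x * y) ≤ x
  x*y≤x {x} {y} 0≤x y≤1 = begin
    x * y   ≤⟨ *-monoʳ-≤-nonNeg 0≤x y≤1 ⟩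
    x * 1#  ≈⟨ *-identityʳ x ⟩
    x       ∎

  x*y∈[0,1] : ∀ {x y} → x ∈[0,1] → y ∈[0,1] → (x * y) ∈[0,1]
  x*y∈[0,1] (0≤x , x≤1) (0≤y , y≤1) = *-nonneg 0≤x 0≤y , ≤-trans (x*y≤x 0≤x y≤1) x≤1

  prod-∈[0,1] : ∀ {a} {X : Set a} {g : X → Carrier} → (∀ x → g x ∈[0,1]) →
                ∀ xs → prod R (map g xs) ∈[0,1]
  prod-∈[0,1] g∈ []       = 0≤1 , ≤-refl
  prod-∈[0,1] g∈ (x ∷ xs) = x*y∈[0,1] (g∈ x) (prod-∈[0,1] g∈ xs)

  x+[1-x]≈1 : ∀ x → x + (1# - x) ≈ 1#
  x+[1-x]≈1 x = begin-equality
    x + (1# - x)  ≈⟨ x∙yz≈y∙xz x 1# (- x) ⟩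
    1# + (x - x)  ≈⟨ +-congˡ (-‿inverseʳ x) ⟩
    1# + 0#       ≈⟨ +-identityʳ 1# ⟩
    1#            ∎

  x+y≤x*y+1 : ∀ {x y} → x ∈[0,1] → y ∈[0,1] → (x + y) ≤ (x * y + 1#)
  x+y≤x*y+1 {x} {y} x∈ (_ , y≤1) = begin
    x + y                         ≈⟨ +-congˡ (*-identityˡ y) ⟨
    x + 1# * y                    ≈⟨ +-congˡ (*-congʳ (x+[1-x]≈1 x)) ⟨
    x + (x + (1# - x)) * y        ≈⟨ +-congˡ (distribʳ y x (1# - x)) ⟩
    x + (x * y + (1# - x) * y)    ≤⟨ +-monoʳ-≤ x (+-monoʳ-≤ (x * y) (x*y≤x 0≤1-x y≤1)) ⟩
    x + (x * y + (1# - x))        ≈⟨ x∙yz≈y∙xz x (x * y) (1# - x) ⟩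
    x * y + (x + (1# - x))        ≈⟨ +-congˡ (x+[1-x]≈1 x) ⟩
    x * y + 1#                    ∎
    where
    0≤1-x : 0# ≤ (1# - x)
    0≤1-x = proj₁ (1-x∈[0,1] x∈)

  sumFin-mono : ∀ {n} {g h : Fin n → Carrier} → (∀ u → g u ≤ h u) → sumFin R g ≤ sumFin R h
  sumFin-mono {zero}  g≤h = ≤-refl
  sumFin-mono {suc n} g≤h = +-mono-≤ (g≤h Fin.zero) (sumFin-mono (λ u → g≤h (Fin.suc u)))

  sumFin-+ : ∀ {n} (g h : Fin n → Carrier) → sumFin R (λ u → g u + h u) ≈ sumFin R g + sumFin R h
  sumFin-+ {zero}  g h = sym (+-identityʳ 0#)
  sumFin-+ {suc n} g h = trans (+-congˡ (sumFin-+ (λ u → g (Fin.suc u)) (λ u → h (Fin.suc u))))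
                               (interchange _ _ _ _)

  sumFin-≈0 : ∀ {n} {g : Fin n → Carrier} → (∀ u → g u ≈ 0#) → sumFin R g ≈ 0#
  sumFin-≈0 {zero}  g≈0 = refl
  sumFin-≈0 {suc n} g≈0 = trans (+-cong (g≈0 Fin.zero) (sumFin-≈0 (λ u → g≈0 (Fin.suc u))))
                                (+-identityʳ 0#)

module OrderedSubmodularity {c ℓ ℓ'} (R : OrderedCommRing c ℓ ℓ') where
  open OrderedCommRing R
  open IsTotalOrder isTotalOrder using () renaming (refl to ≤-refl)
  open OrderedCommRingProperties R
  open PartialOrderReasoning poset

  module _ {a} {X : Set a} where

    OrderedSubmodular⁺ : (List X → Carrier) → Set (a ⊔ ℓ')
    OrderedSubmodular⁺ f = ∀ A B s s̄ →
      (f (A ++ (s ∷ B)) + f A) ≤ (f (A ∷ʳ s) + f (A ++ (s̄ ∷ B)))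

    OrderedSupermodular⁺ : (List X → Carrier) → Set (a ⊔ ℓ')
    OrderedSupermodular⁺ g = ∀ A B s s̄ →
      (g (A ∷ʳ s) + g (A ++ (s̄ ∷ B))) ≤ (g (A ++ (s ∷ B)) + g A)

    orderedSubmodular⁺⇒orderedSubmodular : ∀ {f} → OrderedSubmodular⁺ f → OrderedSubmodular R f
    orderedSubmodular⁺⇒orderedSubmodular f-sub A B s s̄ = x+w≤z+y⇒x-y≤z-w (f-sub A B s s̄)

    orderedSubmodular⇒orderedSubmodular⁺ : ∀ {f} → OrderedSubmodular R f → OrderedSubmodular⁺ f
    orderedSubmodular⇒orderedSubmodular⁺ f-sub A B s s̄ = x-y≤z-w⇒x+w≤z+y (f-sub A B s s̄)

    1-orderedSubmodular⁺ : ∀ {g} → OrderedSupermodular⁺ g → OrderedSubmodular⁺ (λ S → 1# - g S)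
    1-orderedSubmodular⁺ g-sup A B s s̄ = x+y≤z+w⇒[k-z]+[k-w]≤[k-x]+[k-y] 1# (g-sup A B s s̄)

    *-orderedSubmodular⁺ : ∀ {k g} → 0# ≤ k → OrderedSubmodular⁺ g → OrderedSubmodular⁺ (λ S → k * g S)
    *-orderedSubmodular⁺ {k} {g} 0≤k g-sub A B s s̄ = begin
      k * g (A ++ (s ∷ B)) + k * g A        ≈⟨ distribˡ k _ _ ⟨
      k * (g (A ++ (s ∷ B)) + g A)          ≤⟨ *-monoʳ-≤-nonNeg 0≤k (g-sub A B s s̄) ⟩
      k * (g (A ∷ʳ s) + g (A ++ (s̄ ∷ B)))  ≈⟨ distribˡ k _ _ ⟩
      k * g (A ∷ʳ s) + k * g (A ++ (s̄ ∷ B)) ∎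

    sumFin-orderedSubmodular⁺ : ∀ {n} {g : Fin n → List X → Carrier} →
      (∀ u → OrderedSubmodular⁺ (g u)) → OrderedSubmodular⁺ (λ S → sumFin R (λ u → g u S))
    sumFin-orderedSubmodular⁺ {g = g} g-sub A B s s̄ = begin
      sumFin R (λ u → g u (A ++ (s ∷ B))) + sumFin R (λ u → g u A)
        ≈⟨ sumFin-+ (flip g (A ++ (s ∷ B))) (flip g A) ⟨
      sumFin R (λ u → g u (A ++ (s ∷ B)) + g u A)
        ≤⟨ sumFin-mono (λ u → g-sub u A B s s̄) ⟩
      sumFin R (λ u → g u (A ∷ʳ s) + g u (A ++ (s̄ ∷ B)))
        ≈⟨ sumFin-+ (flip g (A ∷ʳ s)) (flip g (A ++ (s̄ ∷ B))) ⟩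
      sumFin R (λ u → g u (A ∷ʳ s)) + sumFin R (λ u → g u (A ++ (s̄ ∷ B)))
        ∎

    prefixProd-orderedSupermodular⁺ : ∀ {q : X → Carrier} → (∀ x → q x ∈[0,1]) →
      ∀ n → OrderedSupermodular⁺ (λ S → prod R (map q (take n S)))
    prefixProd-orderedSupermodular⁺ q∈ zero A B s s̄ = ≤-refl
    prefixProd-orderedSupermodular⁺ {q} q∈ (suc n) (x ∷ A) B s s̄ = begin
      q x * Q (A ∷ʳ s) + q x * Q (A ++ (s̄ ∷ B))  ≈⟨ distribˡ (q x) _ _ ⟨
      q x * (Q (A ∷ʳ s) + Q (A ++ (s̄ ∷ B)))      ≤⟨ *-monoʳ-≤-nonNeg (proj₁ (q∈ x)) IH ⟩
      q x * (Q (A ++ (s ∷ B)) + Q A)              ≈⟨ distribˡ (q x) _ _ ⟩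
      q x * Q (A ++ (s ∷ B)) + q x * Q A          ∎
      where
      Q : List X → Carrier
      Q S = prod R (map q (take n S))
      IH = prefixProd-orderedSupermodular⁺ q∈ n A B s s̄
    prefixProd-orderedSupermodular⁺ {q} q∈ (suc n) [] B s s̄ = begin
      q s * Q [] + q s̄ * Q B  ≡⟨ ≡.cong (λ S → q s * prod R (map q S) + q s̄ * Q B) (take-[] n) ⟩
      q s * 1# + q s̄ * Q B    ≈⟨ +-congʳ (*-identityʳ (q s)) ⟩
      q s + q s̄ * Q B         ≤⟨ +-monoʳ-≤ (q s) (*-monoˡ-≤-nonNeg (proj₁ QB∈) (proj₂ (q∈ s̄))) ⟩
      q s + 1# * Q B          ≈⟨ +-congˡ (*-identityˡ (Q B)) ⟩
      q s + Q B               ≤⟨ x+y≤x*y+1 (q∈ s) QB∈ ⟩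
      q s * Q B + 1#          ∎
      where
      Q : List X → Carrier
      Q S = prod R (map q (take n S))
      QB∈ : Q B ∈[0,1]
      QB∈ = prod-∈[0,1] q∈ (take n B)

  module _ {a} {X : Set a} {f : List X → Carrier} (f-sub : OrderedSubmodular R f) where

    greedy-exchange : ∀ {A} → Greedy R f A → ∀ T → length T ≡ length A → ∀ B →
                      (f (T ++ B) + f []) ≤ (f (A ++ B) + f A)
    greedy-exchange start [] _ B = ≤-refl
    greedy-exchange (step {A} x greedy x-best) T |T|≡|Ax| B with initLast T
    ... | [] = ⊥-elim (ℕ.0≢1+n (≡.trans |T|≡|Ax| (length-∷ʳ A x)))
    ... | T ∷ʳ′ t = begin
      f ((T ∷ʳ t) ++ B) + f []      ≡⟨ ≡.cong (λ L → f L + f []) (++-assoc T [ t ] B) ⟩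
      f (T ++ (t ∷ B)) + f []       ≤⟨ greedy-exchange greedy T |T|≡|A| (t ∷ B) ⟩
      f (A ++ (t ∷ B)) + f A        ≤⟨ orderedSubmodular⇒orderedSubmodular⁺ f-sub A B t x ⟩
      f (A ∷ʳ t) + f (A ++ (x ∷ B)) ≤⟨ +-mono (f (A ++ (x ∷ B))) (x-best t) ⟩
      f (A ∷ʳ x) + f (A ++ (x ∷ B)) ≈⟨ +-comm _ _ ⟩
      f (A ++ (x ∷ B)) + f (A ∷ʳ x) ≡⟨ ≡.cong (λ L → f L + f (A ∷ʳ x)) (++-assoc A [ x ] B) ⟨
      f ((A ∷ʳ x) ++ B) + f (A ∷ʳ x) ∎
      where
      |T|≡|A| : length T ≡ length A
      |T|≡|A| = ℕ.suc-injective (≡.trans (≡.sym (length-∷ʳ T t)) (≡.trans |T|≡|Ax| (length-∷ʳ A x)))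

    greedy-half-approximation : f [] ≈ 0# → ∀ {A} → Greedy R f A →
                                ∀ S → length S ≡ length A → f S ≤ (f A + f A)
    greedy-half-approximation f[]≈0 {A} greedy S |S|≡|A| = begin
      f S                  ≈⟨ +-identityʳ (f S) ⟨
      f S + 0#             ≈⟨ +-congˡ f[]≈0 ⟨
      f S + f []           ≡⟨ ≡.cong (λ L → f L + f []) (++-identityʳ S) ⟨
      f (S ++ []) + f []   ≤⟨ greedy-exchange greedy S |S|≡|A| [] ⟩
      f (A ++ []) + f A    ≡⟨ ≡.cong (λ L → f L + f A) (++-identityʳ A) ⟩
      f A + f A            ∎

  module _ {nU nM} (π : Fin nU → Carrier) (p : Fin nM → Fin nU → Carrier) (θ : Fin nU → ℕ) where

    movieF-orderedSubmodular : (∀ u → 0# ≤ π u) → (∀ m u → p m u ∈[0,1]) →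
                               OrderedSubmodular R (movieF R π p θ)
    movieF-orderedSubmodular 0≤π p∈ = orderedSubmodular⁺⇒orderedSubmodular
      (sumFin-orderedSubmodular⁺ λ u → *-orderedSubmodular⁺ (0≤π u) (1-orderedSubmodular⁺
        (prefixProd-orderedSupermodular⁺ (λ m → 1-x∈[0,1] (p∈ m u)) (θ u))))

    movieF-[]≈0 : movieF R π p θ [] ≈ 0#
    movieF-[]≈0 = sumFin-≈0 λ u → begin-equality
      π u * (1# - prod R (map (λ m → 1# - p m u) (take (θ u) [])))
        ≡⟨ ≡.cong (λ S → π u * (1# - prod R (map (λ m → 1# - p m u) S))) (take-[] (θ u)) ⟩
      π u * (1# - 1#)  ≈⟨ *-congˡ (-‿inverseʳ 1#) ⟩
      π u * 0#         ≈⟨ zeroʳ (π u) ⟩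
      0#               ∎

theorem1 : ∀ {c ℓ ℓ'} (R : OrderedCommRing c ℓ ℓ') → let open OrderedCommRing R in
    ∀ (nU nM : ℕ)
      (π : Fin nU → Carrier) (p : Fin nM → Fin nU → Carrier) (θ : Fin nU → ℕ) →
      (∀ u → 0# ≤ π u) → sumFin R π ≈ 1# →
      (∀ m u → (0# ≤ p m u) × (p m u ≤ 1#)) →
      (∀ u → 0 < θ u) →
      OrderedSubmodular R (movieF R π p θ)
      × (∀ (k : ℕ) → 1 Data.Nat.≤ k → ∀ (A : List (Fin nM)) → Greedy R (movieF R π p θ) A →
           length A ≡ k → ∀ (S : List (Fin nM)) → length S ≡ k →
           movieF R π p θ S ≤ (movieF R π p θ A + movieF R π p θ A))
theorem1 R nU nM π p θ 0≤π _ p∈[0,1] _ =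
  f-sub , λ k _ A greedy |A|≡k S |S|≡k →
    greedy-half-approximation f-sub (movieF-[]≈0 π p θ) greedy S (≡.trans |S|≡k (≡.sym |A|≡k))
  where
  open OrderedSubmodularity R
  f-sub : OrderedSubmodular R (movieF R π p θ)
  f-sub = movieF-orderedSubmodular π p θ 0≤π p∈[0,1]
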